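{- For any DIBI frame $\mathcal{X}$, the complex algebra $Com(\mathcal{X})$ is a DIBI algebra.
   Context: A DIBI frame is $\mathcal{X}=(X,\sqsubseteq,\oplus,\odot,E)$ with $\sqsubseteq$ a preorder on $X$, $E\subseteq X$, $\oplus,\odot:X\times X\to\mathcal P(X)$, satisfying (free variables universally quantified): ($\oplus$ Down-Closed) $z\in x\oplus y$, $x\sqsupseteq x'$, $y\sqsupseteq y'$ imply $\exists z'(z\sqsupseteq z'\wedge z'\in x'\oplus y')$; ($\odot$ Up-Closed) $z\in x\odot y$, $z'\sqsupseteq z$ imply $\exists x',y'(x'\sqsupseteq x\wedge y'\sqsupseteq y\wedge z'\in x'\odot y')$; ($\oplus$ Comm.) $z\in x\oplus y\Rightarrow z\in y\oplus x$; ($\oplus$ Assoc.) $w\in t\oplus z\wedge t\in x\oplus y\Rightarrow\exists s(s\in y\oplus z\wedge w\in x\oplus s)$; ($\oplus$ Unit Existence) $\exists e\in E(x\in e\oplus x)$; ($\oplus$ Unit Coherence) $e\in E\wedge x\in y\oplus e\Rightarrow x\sqsupseteq y$; ($\odot$ Assoc.) $\exists t(w\in t\odot z\wedge t\in x\odot y)\Leftrightarrow\exists s(s\in y\odot z\wedge w\in x\odot s)$; ($\odot$ Unit Existence$_L$) $\exists e\in E(x\in e\odot x)$; ($\odot$ Unit Existence$_R$) $\exists e\in E(x\in x\odot e)$; ($\odot$ Coherence$_R$) $e\in E\wedge x\in y\odot e\Rightarrow x\sqsupseteq y$; (Unit Closure) $e\in E\wedge e'\sqsupseteq e\Rightarrow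 e'\in E$; (Reverse Exchange) $x\in y\oplus z\wedge y\in y_1\odot y_2\wedge z\in z_1\odot z_2\Rightarrow\exists u,v(u\in y_1\oplus z_1\wedge v\in y_2\oplus z_2\wedge x\in u\odot v)$. The complex algebra is $Com(\mathcal{X})=(\mathcal{P}_{\sqsubseteq}(X),\cap,\cup,\Rightarrow,X,\emptyset,\bullet,\multimap_\bullet,\triangleright,\multimap_r,\multimap_l,E)$ where $\mathcal P_\sqsubseteq(X)$ is the set of upward-closed subsets of $X$ and: $A\Rightarrow B=\{a\mid\forall b\sqsupseteq a,\ b\in A\Rightarrow b\in B\}$; $A\bullet B=\{x\mid\exists x',a,b:\ x\sqsupseteq x'\in a\oplus b,\ a\in A,\ b\in B\}$; $A\multimap_\bullet B=\{x\mid\forall a,b:\ b\in x\oplus a\wedge a\in A\Rightarrow b\in B\}$; $A\triangleright B=\{x\mid\exists a,b:\ x\in a\odot b,\ a\in A,\ b\in B\}$; $A\multimap_r B=\{x\mid\forall x',a,b:\ x\sqsubseteq x'\wedge b\in x'\odot a\wedge a\in A\Rightarrow b\in B\}$; $A\multimap_l B=\{x\mid\forall x',a,b:\ x\sqsubseteq x'\wedge b\in a\odot x'\wedge a\in A\Rightarrow b\in B\}$; the unit is $E$. A DIBI algebra is $(A,\wedge,\vee,\to,\top,\bot,*,\mathrel{ -\!\!*},\triangleright,\multimap_r,\multimap_l,I)$ such that for all $a,b,c,d$: $(A,\wedge,\vee,\to,\top,\bot)$ is a Heyting algebra; $(A,*,I)$ is a commutative monoid; $\triangleright$ is associative with right unit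 $I$ and $a\le I\triangleright a$; $a*b\le c$ iff $a\le b\mathrel{ -\!\!*}c$; $a\triangleright b\le c$ iff $a\le b\multimap_r c$ iff $b\le a\multimap_l c$; $(a\triangleright b)*(c\triangleright d)\le(a*c)\triangleright(b*d)$. -}

module Defs where

open import Level using (Level; suc; _⊔_; Lift; lift)
open import Data.Product using (Σ; ∃; ∃-syntax; _×_; _,_)
open import Data.Sum using (_⊎_; inj₁; inj₂)
open import Data.Empty using (⊥)
open import Data.Unit using (⊤)
open import Algebra.Core using (Op₂)
open import Algebra.Structures using (IsCommutativeMonoid)
open import Relation.Binary.Core using (Rel)
open import Relation.Binary.Lattice.Structures using (IsHeytingAlgebra)

record DIBIFrame (ℓ : Level) : Set (suc ℓ) where
  field
    X       : Set ℓ
    _⊑_     : X → X → Set ℓ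
    _∈_⊕_   : X → X → X → Set ℓ
    _∈_⊙_   : X → X → X → Set ℓ
    E       : X → Set ℓ

    ⊑-refl  : ∀ {x} → x ⊑ x
    ⊑-trans : ∀ {x y z} → x ⊑ y → y ⊑ z → x ⊑ z

    ⊕-downClosed : ∀ {x y z x' y'} → z ∈ x ⊕ y → x' ⊑ x → y' ⊑ y →
                   ∃[ z' ] (z' ⊑ z × z' ∈ x' ⊕ y')
    ⊙-upClosed : ∀ {x y z z'} → z ∈ x ⊙ y → z ⊑ z' →
                 ∃[ x' ] ∃[ y' ] (x ⊑ x' × y ⊑ y' × z' ∈ x' ⊙ y')
    ⊕-comm : ∀ {x y z} → z ∈ x ⊕ y → z ∈ y ⊕ x
    ⊕-assoc : ∀ {w t x y z} → w ∈ t ⊕ z → t ∈ x ⊕ y →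
              ∃[ s ] (s ∈ y ⊕ z × w ∈ x ⊕ s)
    ⊕-unitExistence : ∀ x → ∃[ e ] (E e × x ∈ e ⊕ x)
    ⊕-unitCoherence : ∀ {e x y} → E e → x ∈ y ⊕ e → y ⊑ x
    ⊙-assoc₁ : ∀ {w x y z} → ∃[ t ] (w ∈ t ⊙ z × t ∈ x ⊙ y) →
               ∃[ s ] (s ∈ y ⊙ z × w ∈ x ⊙ s)
    ⊙-assoc₂ : ∀ {w x y z} → ∃[ s ] (s ∈ y ⊙ z × w ∈ x ⊙ s) →
               ∃[ t ] (w ∈ t ⊙ z × t ∈ x ⊙ y)
    ⊙-unitExistenceL : ∀ x → ∃[ e ] (E e × x ∈ e ⊙ x)
    ⊙-unitExistenceR : ∀ x → ∃[ e ] (E e × x ∈ x ⊙ e)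
    ⊙-coherenceR : ∀ {e x y} → E e → x ∈ y ⊙ e → y ⊑ x
    unitClosure : ∀ {e e'} → E e → e ⊑ e' → E e'
    reverseExchange : ∀ {x y z y₁ y₂ z₁ z₂} →
      x ∈ y ⊕ z → y ∈ y₁ ⊙ y₂ → z ∈ z₁ ⊙ z₂ →
      ∃[ u ] ∃[ v ] (u ∈ y₁ ⊕ z₁ × v ∈ y₂ ⊕ z₂ × x ∈ u ⊙ v)

record IsDIBIAlgebra {c ℓ₁ ℓ₂ : Level} {A : Set c}
         (_≈_ : Rel A ℓ₁) (_≤_ : Rel A ℓ₂)
         (_∧_ _∨_ _⇒_ : Op₂ A) (⊤ᴬ ⊥ᴬ : A)
         (_*_ _-*_ _▷_ _⊸r_ _⊸l_ : Op₂ A) (I : A)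
         : Set (c ⊔ ℓ₁ ⊔ ℓ₂) where
  field
    isHeytingAlgebra     : IsHeytingAlgebra _≈_ _≤_ _∨_ _∧_ _⇒_ ⊤ᴬ ⊥ᴬ
    *-isCommutativeMonoid : IsCommutativeMonoid _≈_ _*_ I
    ▷-assoc     : ∀ a b c → ((a ▷ b) ▷ c) ≈ (a ▷ (b ▷ c))
    ▷-identityʳ : ∀ a → (a ▷ I) ≈ a
    ▷-unitˡ-≤   : ∀ a → a ≤ (I ▷ a)
    *-residual  : ∀ a b c → (((a * b) ≤ c) → (a ≤ (b -* c))) ×
                            ((a ≤ (b -* c)) → ((a * b) ≤ c))
    ▷-residualʳ : ∀ a b c → (((a ▷ b) ≤ c) → (a ≤ (b ⊸r c))) ×
                            ((a ≤ (b ⊸r c)) → ((a ▷ b) ≤ c))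
    ▷-residualˡ : ∀ a b c → (((a ▷ b) ≤ c) → (b ≤ (a ⊸l c))) ×
                            ((b ≤ (a ⊸l c)) → ((a ▷ b) ≤ c))
    exchange    : ∀ a b c d → ((a ▷ b) * (c ▷ d)) ≤ ((a * c) ▷ (b * d))

module Complex {ℓ : Level} (𝒳 : DIBIFrame ℓ) where
  open DIBIFrame 𝒳

  record Upset : Set (suc ℓ) where
    constructor upset
    field
      mem : X → Set ℓ
      up  : ∀ {x y} → x ⊑ y → mem x → mem y
  open Upset public

  _⊆_ : Upset → Upset → Set ℓ
  A ⊆ B = ∀ x → mem A x → mem B x

  _≈_ : Upset → Upset → Set ℓ
  A ≈ B = (A ⊆ B) × (B ⊆ A)

  _∩_ : Upset → Upset → Upset
  A ∩ B = upset (λ x → mem A x × mem B x)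
                (λ le (a , b) → up A le a , up B le b)

  _∪_ : Upset → Upset → Upset
  A ∪ B = upset (λ x → mem A x ⊎ mem B x)
                (λ { le (inj₁ a) → inj₁ (up A le a)
                   ; le (inj₂ b) → inj₂ (up B le b) })

  _⇒_ : Upset → Upset → Upset
  A ⇒ B = upset (λ a → ∀ b → a ⊑ b → mem A b → mem B b)
                (λ le h b le' → h b (⊑-trans le le'))

  Top : Upset
  Top = upset (λ _ → Lift ℓ ⊤) (λ _ t → t)

  Bot : Upset
  Bot = upset (λ _ → Lift ℓ ⊥) (λ _ t → t)

  _•_ : Upset → Upset → Upset
  A • B = upset (λ x → ∃[ x' ] ∃[ a ] ∃[ b ]
                         (x' ⊑ x × x' ∈ a ⊕ b × mem A a × mem B b))
                (λ le (x' , a , b , le' , r , ha , hb) →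
                   x' , a , b , ⊑-trans le' le , r , ha , hb)

  _-•_ : Upset → Upset → Upset
  A -• B = upset (λ x → ∀ a b → b ∈ x ⊕ a → mem A a → mem B b)
                 (λ {x} {y} le h a b r ha →
                    let (z' , z'⊑b , r') = ⊕-downClosed r le ⊑-refl
                    in up B z'⊑b (h a z' r' ha))

  _▷_ : Upset → Upset → Upset
  A ▷ B = upset (λ x → ∃[ a ] ∃[ b ] (x ∈ a ⊙ b × mem A a × mem B b))
                (λ le (a , b , r , ha , hb) →
                   let (a' , b' , la , lb , r') = ⊙-upClosed r le
                   in a' , b' , r' , up A la ha , up B lb hb)

  _⊸r_ : Upset → Upset → Upset
  A ⊸r B = upset (λ x → ∀ x' a b → x ⊑ x' → b ∈ x' ⊙ a → mem A a → mem B b)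
                 (λ le h x' a b le' → h x' a b (⊑-trans le le'))

  _⊸l_ : Upset → Upset → Upset
  A ⊸l B = upset (λ x → ∀ x' a b → x ⊑ x' → b ∈ a ⊙ x' → mem A a → mem B b)
                 (λ le h x' a b le' → h x' a b (⊑-trans le le'))

  Unit : Upset
  Unit = upset E (λ le e → unitClosure e le)

  ComIsDIBIAlgebra : Set (suc ℓ)
  ComIsDIBIAlgebra =
    IsDIBIAlgebra _≈_ _⊆_ _∩_ _∪_ _⇒_ Top Bot _•_ _-•_ _▷_ _⊸r_ _⊸l_ Unit

-- Every law of a DIBI algebra lifts one frame axiom to upward-closed sets:
-- the Heyting structure and the three residuations are bookkeeping, the
-- commutative monoid (•, E) comes from the ⊕ axioms, the monoid-like laws
-- of ▷ from the ⊙ axioms, and the exchange law from Reverse Exchange.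
-- Down-Closure of ⊕ absorbs the slack x' ⊑ x built into •, and Up-Closure
-- of ⊙ supplies the same slack for ▷, which has none built in.
module Submission where

open import Defs
open import Level using (Level; lift)
open import Data.Product using (_×_; _,_; proj₁; proj₂)
open import Data.Sum using (inj₁; inj₂)
open import Algebra.Structures using (IsCommutativeMonoid)
open import Algebra.Structures.Biased using (isCommutativeMonoidʳ)
open import Relation.Binary.Structures using (IsEquivalence; IsPartialOrder)
open import Relation.Binary.Lattice.Structures using (IsHeytingAlgebra)

module ComplexAlgebra {ℓ : Level} (𝒳 : DIBIFrame ℓ) where
  open DIBIFrame 𝒳
  open Complex 𝒳

  ⊆-refl : ∀ {A} → A ⊆ A
  ⊆-refl x h = h

  ⊆-trans : ∀ {A B C} → A ⊆ B → B ⊆ C → A ⊆ C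
  ⊆-trans p q x h = q x (p x h)

  ≈-isEquivalence : IsEquivalence _≈_
  ≈-isEquivalence = record
    { refl  = λ {A} → ⊆-refl {A} , ⊆-refl {A}
    ; sym   = λ (p , q) → q , p
    ; trans = λ {A} {B} {C} (p , q) (r , s) →
        ⊆-trans {A} {B} {C} p r , ⊆-trans {C} {B} {A} s q
    }

  ⊆-isPartialOrder : IsPartialOrder _≈_ _⊆_
  ⊆-isPartialOrder = record
    { isPreorder = record
      { isEquivalence = ≈-isEquivalence
      ; reflexive     = proj₁
      ; trans         = λ {A} {B} {C} → ⊆-trans {A} {B} {C}
      }
    ; antisym = _,_
    }

  ∩-∪-isHeytingAlgebra : IsHeytingAlgebra _≈_ _⊆_ _∪_ _∩_ _⇒_ Top Bot
  ∩-∪-isHeytingAlgebra = record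
    { isBoundedLattice = record
      { isLattice = record
        { isPartialOrder = ⊆-isPartialOrder
        ; supremum = λ A B → (λ x → inj₁) , (λ x → inj₂) ,
            λ C p q x → λ { (inj₁ h) → p x h ; (inj₂ h) → q x h }
        ; infimum = λ A B → (λ x → proj₁) , (λ x → proj₂) ,
            λ C p q x h → p x h , q x h
        }
      ; maximum = λ A x h → lift _
      ; minimum = λ A x ()
      }
    ; exponential = λ W A B →
        (λ p x w b x⊑b a → p b (up W x⊑b w , a)) ,
        (λ p x (w , a) → p x w x ⊑-refl a)
    }

  •-cong : ∀ {A A' B B'} → A ≈ A' → B ≈ B' → (A • B) ≈ (A' • B')
  •-cong (A⊆A' , A'⊆A) (B⊆B' , B'⊆B) =
    (λ x (x' , a , b , x'⊑x , r , ha , hb) → x' , a , b , x'⊑x , r , A⊆A' a ha , B⊆B' b hb) ,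
    (λ x (x' , a , b , x'⊑x , r , ha , hb) → x' , a , b , x'⊑x , r , A'⊆A a ha , B'⊆B b hb)

  •-comm-⊆ : ∀ A B → (A • B) ⊆ (B • A)
  •-comm-⊆ A B x (x' , a , b , x'⊑x , r , ha , hb) = x' , b , a , x'⊑x , ⊕-comm r , hb , ha

  •-comm : ∀ A B → (A • B) ≈ (B • A)
  •-comm A B = •-comm-⊆ A B , •-comm-⊆ B A

  •-assoc : ∀ A B C → ((A • B) • C) ≈ (A • (B • C))
  •-assoc A B C = assocʳ , assocˡ
    where
    assocʳ : ((A • B) • C) ⊆ (A • (B • C))
    assocʳ x (x' , t , c , x'⊑x , r , (t' , a , b , t'⊑t , r' , ha , hb) , hc) =
      let (z , z⊑x' , z∈t'⊕c) = ⊕-downClosed r t'⊑t ⊑-refl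
          (s , s∈b⊕c , z∈a⊕s) = ⊕-assoc z∈t'⊕c r'
      in z , a , s , ⊑-trans z⊑x' x'⊑x , z∈a⊕s , ha , (s , b , c , ⊑-refl , s∈b⊕c , hb , hc)

    assocˡ : (A • (B • C)) ⊆ ((A • B) • C)
    assocˡ x (x' , a , s , x'⊑x , r , ha , (s' , b , c , s'⊑s , r' , hb , hc)) =
      let (z , z⊑x' , z∈s'⊕a) = ⊕-downClosed (⊕-comm r) s'⊑s ⊑-refl
          (t , t∈b⊕a , z∈c⊕t) = ⊕-assoc z∈s'⊕a (⊕-comm r')
      in z , t , c , ⊑-trans z⊑x' x'⊑x , ⊕-comm z∈c⊕t ,
         (t , a , b , ⊑-refl , ⊕-comm t∈b⊕a , ha , hb) , hc

  •-identityʳ : ∀ A → (A • Unit) ≈ A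
  •-identityʳ A =
    (λ x (x' , a , e , x'⊑x , r , ha , he) → up A (⊑-trans (⊕-unitCoherence he r) x'⊑x) ha) ,
    (λ x ha → let (e , he , r) = ⊕-unitExistence x
              in x , x , e , ⊑-refl , ⊕-comm r , ha , he)

  •-isCommutativeMonoid : IsCommutativeMonoid _≈_ _•_ Unit
  •-isCommutativeMonoid = isCommutativeMonoidʳ record
    { isSemigroup = record
      { isMagma = record
        { isEquivalence = ≈-isEquivalence
        ; ∙-cong        = λ {A} {A'} {B} {B'} → •-cong {A} {A'} {B} {B'}
        }
      ; assoc = •-assoc
      }
    ; identityʳ = •-identityʳ
    ; comm      = •-comm
    }

  •-residual : ∀ A B C → ((A • B) ⊆ C → A ⊆ (B -• C)) × (A ⊆ (B -• C) → (A • B) ⊆ C)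
  •-residual A B C =
    (λ p x ha b c r hb → p c (c , x , b , ⊑-refl , r , ha , hb)) ,
    (λ p x (x' , a , b , x'⊑x , r , ha , hb) → up C x'⊑x (p a ha b x' r hb))

  ▷-assoc : ∀ A B C → ((A ▷ B) ▷ C) ≈ (A ▷ (B ▷ C))
  ▷-assoc A B C =
    (λ x (t , c , r , (a , b , r' , ha , hb) , hc) →
       let (s , s∈b⊙c , x∈a⊙s) = ⊙-assoc₁ (t , r , r')
       in a , s , x∈a⊙s , ha , (b , c , s∈b⊙c , hb , hc)) ,
    (λ x (a , s , r , ha , (b , c , r' , hb , hc)) →
       let (t , x∈t⊙c , t∈a⊙b) = ⊙-assoc₂ (s , r' , r)
       in t , c , x∈t⊙c , (a , b , t∈a⊙b , ha , hb) , hc)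

  ▷-identityʳ : ∀ A → (A ▷ Unit) ≈ A
  ▷-identityʳ A =
    (λ x (a , e , r , ha , he) → up A (⊙-coherenceR he r) ha) ,
    (λ x ha → let (e , he , r) = ⊙-unitExistenceR x in x , e , r , ha , he)

  ⊆-Unit▷ : ∀ A → A ⊆ (Unit ▷ A)
  ⊆-Unit▷ A x ha = let (e , he , r) = ⊙-unitExistenceL x in e , x , r , he , ha

  ▷-residualʳ : ∀ A B C → ((A ▷ B) ⊆ C → A ⊆ (B ⊸r C)) × (A ⊆ (B ⊸r C) → (A ▷ B) ⊆ C)
  ▷-residualʳ A B C =
    (λ p x ha x' b c x⊑x' r hb → p c (x' , b , r , up A x⊑x' ha , hb)) ,
    (λ p x (a , b , r , ha , hb) → p a ha a b x ⊑-refl r hb)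

  ▷-residualˡ : ∀ A B C → ((A ▷ B) ⊆ C → B ⊆ (A ⊸l C)) × (B ⊆ (A ⊸l C) → (A ▷ B) ⊆ C)
  ▷-residualˡ A B C =
    (λ p x hb x' a c x⊑x' r ha → p c (a , x' , r , ha , up B x⊑x' hb)) ,
    (λ p x (a , b , r , ha , hb) → p b hb b a x ⊑-refl r ha)

  ▷-•-exchange : ∀ A B C D → ((A ▷ B) • (C ▷ D)) ⊆ ((A • C) ▷ (B • D))
  ▷-•-exchange A B C D x (x' , y , z , x'⊑x , r , (a , b , ry , ha , hb) , (c , d , rz , hc , hd)) =
    let (u , v , u∈a⊕c , v∈b⊕d , x'∈u⊙v) = reverseExchange r ry rz
        (u' , v' , u⊑u' , v⊑v' , x∈u'⊙v') = ⊙-upClosed x'∈u⊙v x'⊑x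
    in u' , v' , x∈u'⊙v' ,
       (u , a , c , u⊑u' , u∈a⊕c , ha , hc) , (v , b , d , v⊑v' , v∈b⊕d , hb , hd)

mainTheorem4 : {ℓ : Level} (𝒳 : DIBIFrame ℓ) →
    let open Complex 𝒳 in
    IsDIBIAlgebra _≈_ _⊆_ _∩_ _∪_ _⇒_ Top Bot _•_ _-•_ _▷_ _⊸r_ _⊸l_ Unit
mainTheorem4 𝒳 = record
  { isHeytingAlgebra      = ∩-∪-isHeytingAlgebra
  ; *-isCommutativeMonoid = •-isCommutativeMonoid
  ; ▷-assoc     = ▷-assoc
  ; ▷-identityʳ = ▷-identityʳ
  ; ▷-unitˡ-≤   = ⊆-Unit▷
  ; *-residual  = •-residual
  ; ▷-residualʳ = ▷-residualʳ
  ; ▷-residualˡ = ▷-residualˡ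
  ; exchange    = ▷-•-exchange
  }
  where open ComplexAlgebra 𝒳
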